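{- Let $T$ be a finite tree with edges $e_1,\dots,e_m$, let $u\in V(T)$ and let $k_1,\dots,k_m$ be non-negative integers. For each vertex $v$ let $e^v_1,\dots,e^v_{\deg(v)}$ be the edges incident to $v$ and $k^v_j$ the $k_i$ with $e_i=e^v_j$, and set $s(v)=k^v_1+\dots+k^v_{\deg(v)}$. Then $$\prod_{v\in V(T)}\binom{s(v)-\deg(v)}{k^v_1-1,\,k^v_2-1,\,\dots,\,k^v_{\deg(v)}-1}\;\le\;\mathrm{WB}_T(k_1,\dots,k_m;u)\;\le\;\prod_{v\in V(T)}\binom{s(v)}{k^v_1,\,k^v_2,\,\dots,\,k^v_{\deg(v)}}.$$
   Context: A tour on a graph is a walk $v_0,f_1,v_1,\dots,f_\ell,v_\ell$ with $v_\ell=v_0$, starting and ending at $v_0$. A tour is balanced if each edge is traversed equally often in each direction. $\mathrm{WB}_G(k_1,\dots,k_m;u)$ denotes the number of balanced tours on the graph $G$ (with edges $e_1,\dots,e_m$) starting and ending at vertex $u$ that traverse each edge $e_i$ exactly $k_i$ times in each direction. Multinomial coefficients are $\binom{n}{a_1,\dots,a_r}=\frac{n!}{a_1!\cdots a_r!}$ for $n=a_1+\dots+a_r$, and are taken to be $0$ whenever one or more of the terms is negative. -}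

module Defs where

open import Data.Nat using (ℕ; zero; suc; _+_; _*_; _∸_; _/_; _!; NonZero)
open import Data.Nat.Properties using (_!≢0; m*n≢0)
open import Data.Bool using (Bool; true; false; if_then_else_)
open import Data.Fin using (Fin; _≟_)
open import Data.Product using (_×_; _,_; proj₁; proj₂; Σ; ∃)
open import Data.Sum using (_⊎_)
open import Data.List using (List; []; _∷_; map; length; filter; allFin; concatMap)
open import Data.Nat.ListAction using (sum; product)
import Data.Fin.Properties
open import Data.List.Relation.Unary.All using (All)
open import Data.List.Relation.Unary.Unique.Propositional using (Unique)
open import Relation.Binary.PropositionalEquality using (_≡_)
open import Relation.Nullary using (Dec; yes; no; ¬_)
open import Relation.Nullary.Decidable using (_×-dec_; _⊎-dec_)
open import Data.Maybe using (Maybe; just; nothing)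

-- A tour/walk is recorded as a list of directed
-- steps (e , d): d = true traverses e from proj₁ (ends e) to
-- proj₂ (ends e), d = false traverses it in the opposite direction.

record Graph (n m : ℕ) : Set where
  field
    ends : Fin m → Fin n × Fin n
open Graph public

Step : ℕ → Set
Step m = Fin m × Bool

tail : ∀ {n m} → Graph n m → Step m → Fin n
tail G (e , true)  = proj₁ (ends G e)
tail G (e , false) = proj₂ (ends G e)

head : ∀ {n m} → Graph n m → Step m → Fin n
head G (e , true)  = proj₂ (ends G e)
head G (e , false) = proj₁ (ends G e)

data IsWalk {n m} (G : Graph n m) : Fin n → List (Step m) → Fin n → Set where
  stop : ∀ {v} → IsWalk G v [] v
  step : ∀ {v w} {s ss} → tail G s ≡ v → IsWalk G (head G s) ss w → IsWalk G v (s ∷ ss) w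

isWalk? : ∀ {n m} (G : Graph n m) v ss w → Dec (IsWalk G v ss w)
isWalk? G v [] w with v ≟ w
... | yes Relation.Binary.PropositionalEquality.refl = yes stop
... | no ne = no λ { stop → ne Relation.Binary.PropositionalEquality.refl }
isWalk? G v (s ∷ ss) w with tail G s ≟ v | isWalk? G (head G s) ss w
... | yes p | yes q = yes (step p q)
... | no np | _ = no λ { (step p _) → np p }
... | yes _ | no nq = no λ { (step _ q) → nq q }

Connected : ∀ {n m} → Graph n m → Set
Connected G = ∀ v w → ∃ λ ss → IsWalk G v ss w

-- a cycle-witness: a closed trail (walk with pairwise distinct edges)
-- of positive length
Acyclic : ∀ {n m} → Graph n m → Set
Acyclic G = ∀ v s ss → IsWalk G v (s ∷ ss) v → ¬ Unique (map proj₁ (s ∷ ss))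

IsTree : ∀ {n m} → Graph n m → Set
IsTree G = Connected G × Acyclic G

count : ∀ {A : Set} → (A → Bool) → List A → ℕ
count p [] = 0
count p (x ∷ xs) = (if p x then 1 else 0) + count p xs

isStep : ∀ {m} → Fin m → Bool → Step m → Bool
isStep e d (e' , d') with e ≟ e'
... | no _ = false
... | yes _ with d | d'
... | true  | true  = true
... | false | false = true
... | _     | _     = false

traversals : ∀ {m} → Fin m → Bool → List (Step m) → ℕ
traversals e d ss = count (isStep e d) ss

IsBalancedTour : ∀ {n m} → Graph n m → (Fin m → ℕ) → Fin n → List (Step m) → Set
IsBalancedTour {m = m} G k u ss =
  IsWalk G u ss u × (∀ (e : Fin m) → (traversals e true ss ≡ k e) × (traversals e false ss ≡ k e))

listsOf : ∀ {A : Set} → List A → ℕ → List (List A)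
listsOf xs zero = [] ∷ []
listsOf xs (suc L) = concatMap (λ x → map (x ∷_) (listsOf xs L)) xs

allSteps : ∀ m → List (Step m)
allSteps m = concatMap (λ e → (e , true) ∷ (e , false) ∷ []) (allFin m)

balanced? : ∀ {n m} (G : Graph n m) k u ss → Dec (IsBalancedTour G k u ss)
balanced? {m = m} G k u ss =
  isWalk? G u ss u ×-dec
  Data.Fin.Properties.all? (λ e → (traversals e true ss ≟ℕ k e) ×-dec (traversals e false ss ≟ℕ k e))
  where open import Data.Nat using () renaming (_≟_ to _≟ℕ_)

-- Any such tour has length exactly
-- 2 * Σ_e k e, so we count among all step sequences of that length.
WB : ∀ {n m} → Graph n m → (Fin m → ℕ) → Fin n → ℕ
WB {m = m} G k u =
  length (filter (balanced? G k u) (listsOf (allSteps m) (2 * sum (map k (allFin m)))))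

factProd : List ℕ → ℕ
factProd as = product (map _! as)

factProd≢0 : ∀ as → NonZero (factProd as)
factProd≢0 [] = _
factProd≢0 (a ∷ as) = m*n≢0 (a !) (factProd as) {{a !≢0}} {{factProd≢0 as}}

multinomial : List ℕ → ℕ
multinomial as = ((sum as) ! / factProd as) {{factProd≢0 as}}

-- multinomial (k₁ - 1, …, k_r - 1) with top s - r = Σ (kᵢ - 1),
-- taken to be 0 as soon as some term kᵢ - 1 is negative (kᵢ = 0).
anyZero : List ℕ → Bool
anyZero [] = false
anyZero (zero ∷ _) = true
anyZero (suc _ ∷ ks) = anyZero ks

multinomialPred : List ℕ → ℕ
multinomialPred ks = if anyZero ks then 0 else multinomial (map (λ k → k ∸ 1) ks)

incident? : ∀ {n m} → Graph n m → Fin n → Fin m → Bool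
incident? G v e with proj₁ (ends G e) ≟ v | proj₂ (ends G e) ≟ v
... | no _ | no _ = false
... | _    | _    = true

incidentEdges : ∀ {n m} → Graph n m → Fin n → List (Fin m)
incidentEdges {m = m} G v = Data.List.filter (λ e → Relation.Nullary.Decidable.Core.T? (incident? G v e)) (allFin m)
  where import Relation.Nullary.Decidable.Core

localK : ∀ {n m} → Graph n m → (Fin m → ℕ) → Fin n → List ℕ
localK G k v = map k (incidentEdges G v)

deg : ∀ {n m} → Graph n m → Fin n → ℕ
deg G v = length (incidentEdges G v)

s : ∀ {n m} → Graph n m → (Fin m → ℕ) → Fin n → ℕ
s G k v = sum (localK G k v)

-- A closed walk is determined by its exit lists: for each vertex v, the sequence of edges along
-- which it leaves v.  Starting at u and always leaving the current vertex along the next unused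
-- edge of its list reconstructs the walk.  In a balanced tour the exit list at v contains each
-- incident edge e exactly k e times, so it is one of multinomial (k^v) arrangements: this is the
-- upper bound.  Conversely, root the tree at u and take at each vertex an arrangement of the
-- edges with multiplicities k e - 1, followed by every incident edge once, the edge towards u
-- last.  As in the BEST theorem, following these lists from u uses all of them up: the walk can
-- only get stuck at u, and a vertex with unused exits has not used its last exit, towards u, all
-- k times, so its neighbour towards u was entered too rarely to have used up its own exits.  The
-- result is a balanced tour, different choices give different tours, and if some k e = 0 the
-- lower bound is 0.

module Submission where

open import Defs
open import Data.Nat using (ℕ; zero; suc; _+_; _*_; _∸_; _≤_; _<_; z≤n; s≤s; _!; _/_; NonZero) renaming (_≟_ to _≟ℕ_)
open import Data.Nat.Properties hiding (_≟_; suc-injective)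
open import Data.Nat.Divisibility using (_∣_; ∣-trans; *-monoʳ-∣; ∣-refl)
open import Data.Nat.DivMod using (m*n/n≡m; m*[n/m]≡n)
open import Data.Nat.Combinatorics using (_C_; k![n∸k]!∣n!; nCk+nC[k+1]≡[n+1]C[k+1]; nCn≡1)
open import Data.Nat.Combinatorics.Specification using (nCk≡n!/k![n-k]!)
open import Data.Nat.ListAction using (sum; product)
open import Data.Nat.Solver using (module +-*-Solver)
open import Data.List using (List; []; _∷_; _++_; map; length; concatMap; replicate; [_]; tabulate; allFin; filter)
open import Data.List.Properties
  using (length-++; length-map; length-++-sucʳ; length-replicate; ∷-injectiveˡ; ∷-injectiveʳ;
         map-tabulate; tabulate-cong; map-∘; ++-assoc; ++-identityʳ; ++-cancelʳ)
open import Data.List.Membership.Propositional using (_∈_; _∉_; find)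
open import Data.List.Membership.Propositional.Properties
open import Data.List.Relation.Unary.Any as Any using (Any; here; there)
open import Data.List.Relation.Unary.All as All using (All; []; _∷_)
import Data.List.Relation.Unary.All.Properties as Allₚ
open import Data.List.Relation.Unary.AllPairs using ([]; _∷_)
open import Data.List.Relation.Unary.Unique.Propositional using (Unique)
import Data.List.Relation.Unary.Unique.Propositional.Properties as Unique
open import Data.Vec using (Vec; lookup) renaming ([] to []ᵥ; _∷_ to _∷ᵥ_)
import Data.Vec as Vec
import Data.Vec.Properties as Vec
open import Data.Fin using (Fin) renaming (zero to fzero; suc to fsuc)
open import Data.Fin.Properties using (_≟_; any?; suc-injective)
open import Data.Bool using (Bool; true; false; T; if_then_else_)
open import Data.Product using (Σ; ∃; _×_; _,_; proj₁; proj₂)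
open import Data.Sum using (_⊎_; inj₁; inj₂)
open import Data.Empty using (⊥; ⊥-elim)
open import Relation.Nullary using (Dec; yes; no; does)
open import Relation.Nullary.Decidable.Core using (T?)
open import Relation.Binary.Definitions using (DecidableEquality)
open import Relation.Binary.PropositionalEquality
  using (_≡_; _≢_; refl; sym; trans; cong; cong₂; subst; module ≡-Reasoning)
open import Function using (_∘_)

-- Enumerations and counting by injection

length-≤-injection : ∀ {A B : Set} (f : A → B) (xs : List A) (ys : List B) → Unique xs →
  (∀ {x y} → x ∈ xs → y ∈ xs → f x ≡ f y → x ≡ y) →
  (∀ {x} → x ∈ xs → f x ∈ ys) → length xs ≤ length ys
length-≤-injection f [] ys _ _ _ = z≤n
length-≤-injection f (x ∷ xs) ys (x∉xs ∷ xs!) inj mem with ∈-∃++ (mem (here refl))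
... | ys₁ , ys₂ , refl =
  subst (suc (length xs) ≤_) (sym (length-++-sucʳ ys₁ (f x) ys₂))
    (s≤s (length-≤-injection f xs (ys₁ ++ ys₂) xs! (λ p q → inj (there p) (there q)) mem′))
  where
  mem′ : ∀ {y} → y ∈ xs → f y ∈ ys₁ ++ ys₂
  mem′ {y} y∈xs with ∈-++⁻ ys₁ (mem (there y∈xs))
  ... | inj₁ p = ∈-++⁺ˡ p
  ... | inj₂ (here fy≡fx) = ⊥-elim (All.lookup x∉xs y∈xs (sym (inj (there y∈xs) (here refl) fy≡fx)))
  ... | inj₂ (there p) = ∈-++⁺ʳ ys₁ p

unique-concatMap⁺ : ∀ {A B : Set} (g : A → List B) (xs : List A) → Unique xs →
  (∀ {x} → x ∈ xs → Unique (g x)) →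
  (∀ {x y b} → x ∈ xs → y ∈ xs → b ∈ g x → b ∈ g y → x ≡ y) →
  Unique (concatMap g xs)
unique-concatMap⁺ g [] _ _ _ = []
unique-concatMap⁺ g (x ∷ xs) (x∉xs ∷ xs!) g! disjoint =
  Unique.++⁺ (g! (here refl))
    (unique-concatMap⁺ g xs xs! (g! ∘ there) (λ p q → disjoint (there p) (there q)))
    λ { (b∈gx , b∈rest) → notLater b∈gx (∈-concatMap⁻ g b∈rest) }
  where
  notLater : ∀ {b} → b ∈ g x → Any (λ y → b ∈ g y) xs → ⊥
  notLater b∈gx later with find later
  ... | y , y∈xs , b∈gy = All.lookup x∉xs y∈xs (disjoint (here refl) (there y∈xs) b∈gx b∈gy)

length-concatMap-const : ∀ {A B : Set} (g : A → List B) (c : ℕ) (xs : List A) →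
  (∀ {x} → x ∈ xs → length (g x) ≡ c) → length (concatMap g xs) ≡ length xs * c
length-concatMap-const g c [] _ = refl
length-concatMap-const g c (x ∷ xs) len =
  trans (length-++ (g x)) (cong₂ _+_ (len (here refl)) (length-concatMap-const g c xs (len ∘ there)))
prefix-of-init : ∀ {A : Set} (xs : List A) y ys zs z → xs ++ y ∷ ys ≡ zs ++ [ z ] → ∃ λ Q → zs ≡ xs ++ Q
prefix-of-init [] y ys zs z _ = zs , refl
prefix-of-init (x ∷ []) y ys [] z ()
prefix-of-init (x ∷ x′ ∷ xs) y ys [] z ()
prefix-of-init (x ∷ xs) y ys (z′ ∷ zs) z eq with prefix-of-init xs y ys zs z (∷-injectiveʳ eq)
... | Q , zs≡ = Q , cong₂ _∷_ (sym (∷-injectiveˡ eq)) zs≡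

module _ {A : Set} where

  ∈-listsOf⁻ : ∀ (xs : List A) L {ys} → ys ∈ listsOf xs L → length ys ≡ L
  ∈-listsOf⁻ xs zero (here refl) = refl
  ∈-listsOf⁻ xs (suc L) p with find (∈-concatMap⁻ (λ x → map (x ∷_) (listsOf xs L)) {xs = xs} p)
  ... | x , _ , q with ∈-map⁻ (x ∷_) q
  ... | ys , ys∈ , refl = cong suc (∈-listsOf⁻ xs L ys∈)

  ∈-listsOf⁺ : ∀ (xs : List A) ys → All (_∈ xs) ys → ys ∈ listsOf xs (length ys)
  ∈-listsOf⁺ xs [] _ = here refl
  ∈-listsOf⁺ xs (y ∷ ys) (y∈xs ∷ ys⊆xs) =
    ∈-concatMap⁺ (λ x → map (x ∷_) (listsOf xs (length ys)))
      (Any.map (λ { refl → ∈-map⁺ (y ∷_) (∈-listsOf⁺ xs ys ys⊆xs) }) y∈xs)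

  listsOf-unique : ∀ (xs : List A) L → Unique xs → Unique (listsOf xs L)
  listsOf-unique xs zero _ = [] ∷ []
  listsOf-unique xs (suc L) xs! =
    unique-concatMap⁺ (λ x → map (x ∷_) (listsOf xs L)) xs xs!
      (λ _ → Unique.map⁺ ∷-injectiveʳ (listsOf-unique xs L xs!))
      λ _ _ p q → sameHead (∈-map⁻ _ p) (∈-map⁻ _ q)
    where
    sameHead : ∀ {x y zs} → (∃ λ t → t ∈ listsOf xs L × zs ≡ x ∷ t) →
               (∃ λ t → t ∈ listsOf xs L × zs ≡ y ∷ t) → x ≡ y
    sameHead (_ , _ , refl) (_ , _ , refl) = refl

module _ {X : Set} where

  choices : ∀ {n} → (Fin n → List X) → List (Vec X n)
  choices {zero} L = []ᵥ ∷ []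
  choices {suc n} L = concatMap (λ x → map (x ∷ᵥ_) (choices (L ∘ fsuc))) (L fzero)

  length-choices : ∀ {n} (L : Fin n → List X) → length (choices L) ≡ product (tabulate (length ∘ L))
  length-choices {zero} L = refl
  length-choices {suc n} L =
    length-concatMap-const (λ x → map (x ∷ᵥ_) (choices (L ∘ fsuc))) _ (L fzero)
      (λ {x} _ → trans (length-map (x ∷ᵥ_) (choices (L ∘ fsuc))) (length-choices (L ∘ fsuc)))

  ∈-choices⁺ : ∀ {n} (L : Fin n → List X) (v : Vec X n) → (∀ i → lookup v i ∈ L i) → v ∈ choices L
  ∈-choices⁺ {zero} L []ᵥ _ = here refl
  ∈-choices⁺ {suc n} L (x ∷ᵥ v) v∈ =
    ∈-concatMap⁺ (λ a → map (a ∷ᵥ_) (choices (L ∘ fsuc)))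
      (Any.map (λ { refl → ∈-map⁺ (x ∷ᵥ_) (∈-choices⁺ (L ∘ fsuc) v (v∈ ∘ fsuc)) }) (v∈ fzero))

  ∈-choices⁻ : ∀ {n} (L : Fin n → List X) {v : Vec X n} → v ∈ choices L → ∀ i → lookup v i ∈ L i
  ∈-choices⁻ {suc n} L p i with find (∈-concatMap⁻ (λ a → map (a ∷ᵥ_) (choices (L ∘ fsuc))) {xs = L fzero} p)
  ... | x , x∈ , q with ∈-map⁻ (x ∷ᵥ_) q
  ∈-choices⁻ {suc n} L p fzero    | x , x∈ , q | v , v∈ , refl = x∈
  ∈-choices⁻ {suc n} L p (fsuc i) | x , x∈ , q | v , v∈ , refl = ∈-choices⁻ (L ∘ fsuc) v∈ i

  choices-unique : ∀ {n} (L : Fin n → List X) → (∀ i → Unique (L i)) → Unique (choices L)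
  choices-unique {zero} L _ = [] ∷ []
  choices-unique {suc n} L L! =
    unique-concatMap⁺ (λ x → map (x ∷ᵥ_) (choices (L ∘ fsuc))) (L fzero) (L! fzero)
      (λ _ → Unique.map⁺ Vec.∷-injectiveʳ (choices-unique (L ∘ fsuc) (L! ∘ fsuc)))
      λ _ _ p q → sameHead (∈-map⁻ _ p) (∈-map⁻ _ q)
    where
    sameHead : ∀ {x y w} → (∃ λ v → v ∈ choices (L ∘ fsuc) × w ≡ x ∷ᵥ v) →
               (∃ λ v → v ∈ choices (L ∘ fsuc) × w ≡ y ∷ᵥ v) → x ≡ y
    sameHead (_ , _ , refl) (_ , _ , refl) = refl

length-choices-product : ∀ {X : Set} {n} (L : Fin n → List X) (f : Fin n → ℕ) → (∀ i → length (L i) ≡ f i) →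
  length (choices L) ≡ product (map f (allFin n))
length-choices-product L f len≡ =
  trans (length-choices L) (trans (cong product (tabulate-cong len≡)) (cong product (sym (map-tabulate (λ i → i) f))))

lookup-injective : ∀ {X : Set} {n} (v w : Vec X n) → (∀ i → lookup v i ≡ lookup w i) → v ≡ w
lookup-injective v w eq = trans (sym (Vec.tabulate∘lookup v)) (trans (Vec.tabulate-cong eq) (Vec.tabulate∘lookup w))

factProd∣sum! : ∀ cs → factProd cs ∣ sum cs !
factProd∣sum! [] = ∣-refl
factProd∣sum! (c ∷ cs) = ∣-trans (*-monoʳ-∣ (c !) (factProd∣sum! cs))
  (subst (λ z → c ! * z ! ∣ (c + sum cs) !) (m+n∸m≡n c (sum cs)) (k![n∸k]!∣n! (m≤m+n c (sum cs))))

multinomial-∷ : ∀ c cs → multinomial (c ∷ cs) ≡ ((c + sum cs) C c) * multinomial cs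
multinomial-∷ c cs = begin
    N ! / (c ! * F)                     ≡⟨ cong (λ z → (z / (c ! * F)) {{c!F≢0}}) N!≡ ⟩
    ((q₁ * q₂) * (c ! * F)) / (c ! * F) ≡⟨ m*n/n≡m (q₁ * q₂) (c ! * F) ⟩
    q₁ * q₂                             ≡⟨ cong (_* q₂) (sym binomial) ⟩
    (N C c) * q₂                        ∎
  where
  open ≡-Reasoning
  S = sum cs
  N = c + S
  F = factProd cs
  instance
    F≢0 : NonZero F
    F≢0 = factProd≢0 cs
    c!S!≢0 : NonZero (c ! * S !)
    c!S!≢0 = m*n≢0 (c !) (S !) {{c !≢0}} {{S !≢0}}
    c!F≢0 : NonZero (c ! * F)
    c!F≢0 = factProd≢0 (c ∷ cs)
  q₁ = N ! / (c ! * S !)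
  q₂ = S ! / F
  binomial : N C c ≡ q₁
  binomial = trans (nCk≡n!/k![n-k]! (m≤m+n c S))
    (cong (λ z → (N ! / (c ! * z !)) {{m*n≢0 (c !) (z !) {{c !≢0}} {{z !≢0}}}}) (m+n∸m≡n c S))
  c!S!∣N! : c ! * S ! ∣ N !
  c!S!∣N! = subst (λ z → c ! * z ! ∣ N !) (m+n∸m≡n c S) (k![n∸k]!∣n! (m≤m+n c S))
  open +-*-Solver
  N!≡ : N ! ≡ (q₁ * q₂) * (c ! * F)
  N!≡ = begin
    N !                   ≡⟨ sym (m*[n/m]≡n c!S!∣N!) ⟩
    (c ! * S !) * q₁      ≡⟨ cong (λ z → (c ! * z) * q₁) (sym (m*[n/m]≡n (factProd∣sum! cs))) ⟩
    (c ! * (F * q₂)) * q₁ ≡⟨ solve 4 (λ a f x y → (a :* (f :* y)) :* x := (x :* y) :* (a :* f))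
                                   refl (c !) F q₁ q₂ ⟩
    (q₁ * q₂) * (c ! * F) ∎

product≡0 : ∀ {xs} → 0 ∈ xs → product xs ≡ 0
product≡0 {x ∷ xs} (here refl) = refl
product≡0 {x ∷ xs} (there 0∈xs) = trans (cong (x *_) (product≡0 0∈xs)) (*-zeroʳ x)

anyZero≡true : ∀ ks → 0 ∈ ks → anyZero ks ≡ true
anyZero≡true (zero ∷ ks) _ = refl
anyZero≡true (suc _ ∷ ks) (there 0∈ks) = anyZero≡true ks 0∈ks

anyZero≡false : ∀ ks → All (λ k → k ≢ 0) ks → anyZero ks ≡ false
anyZero≡false [] _ = refl
anyZero≡false (zero ∷ ks) (0≢0 ∷ _) = ⊥-elim (0≢0 refl)
anyZero≡false (suc _ ∷ ks) (_ ∷ ks≢0) = anyZero≡false ks ks≢0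

multinomialPred-∋0 : ∀ ks → 0 ∈ ks → multinomialPred ks ≡ 0
multinomialPred-∋0 ks 0∈ks rewrite anyZero≡true ks 0∈ks = refl

multinomialPred-positive : ∀ ks → All (λ k → k ≢ 0) ks → multinomialPred ks ≡ multinomial (map (_∸ 1) ks)
multinomialPred-positive ks ks≢0 rewrite anyZero≡false ks ks≢0 = refl

module _ {A : Set} {f g : A → ℕ} where

  sum-map-cong : ∀ xs → (∀ {x} → x ∈ xs → f x ≡ g x) → sum (map f xs) ≡ sum (map g xs)
  sum-map-cong [] _ = refl
  sum-map-cong (x ∷ xs) f≡g = cong₂ _+_ (f≡g (here refl)) (sum-map-cong xs (f≡g ∘ there))

  sum-map-mono : ∀ xs → (∀ {x} → x ∈ xs → f x ≤ g x) → sum (map f xs) ≤ sum (map g xs)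
  sum-map-mono [] _ = z≤n
  sum-map-mono (x ∷ xs) f≤g = +-mono-≤ (f≤g (here refl)) (sum-map-mono xs (f≤g ∘ there))

  sum-map-mono-< : ∀ xs → (∀ {x} → x ∈ xs → f x ≤ g x) → ∀ {y} → y ∈ xs → f y < g y →
    sum (map f xs) < sum (map g xs)
  sum-map-mono-< (x ∷ xs) f≤g (here refl) fy<gy = +-mono-<-≤ fy<gy (sum-map-mono xs (f≤g ∘ there))
  sum-map-mono-< (x ∷ xs) f≤g (there y∈) fy<gy = +-mono-≤-< (f≤g (here refl)) (sum-map-mono-< xs (f≤g ∘ there) y∈ fy<gy)

  sum-map-+ : ∀ xs → sum (map (λ x → f x + g x) xs) ≡ sum (map f xs) + sum (map g xs)
  sum-map-+ [] = refl
  sum-map-+ (x ∷ xs) = trans (cong (f x + g x +_) (sum-map-+ xs)) (interchange (f x) (g x) _ _)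
    where
    open +-*-Solver
    interchange : ∀ a b c d → a + b + (c + d) ≡ a + c + (b + d)
    interchange = solve 4 (λ a b c d → a :+ b :+ (c :+ d) := a :+ c :+ (b :+ d)) refl

sumFin : ∀ {N} → (Fin N → ℕ) → ℕ
sumFin {N} g = sum (map g (allFin N))

sumFin-suc : ∀ {N} (g : Fin (suc N) → ℕ) → sumFin g ≡ g fzero + sumFin (g ∘ fsuc)
sumFin-suc {N} g = cong (λ gs → g fzero + sum gs)
  (trans (map-tabulate fsuc g) (sym (map-tabulate (λ i → i) (g ∘ fsuc))))

sumFin-cong : ∀ {N} {g h : Fin N → ℕ} → (∀ x → g x ≡ h x) → sumFin g ≡ sumFin h
sumFin-cong {N} g≡h = sum-map-cong (allFin N) λ {x} _ → g≡h x

sumFin-zero : ∀ {N} (g : Fin N → ℕ) → (∀ x → g x ≡ 0) → sumFin g ≡ 0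
sumFin-zero {zero} g _ = refl
sumFin-zero {suc N} g g≡0 = trans (sumFin-suc g) (cong₂ _+_ (g≡0 fzero) (sumFin-zero (g ∘ fsuc) (g≡0 ∘ fsuc)))

sumFin-single : ∀ {N} (g : Fin N → ℕ) (v : Fin N) → (∀ x → x ≢ v → g x ≡ 0) → sumFin g ≡ g v
sumFin-single {suc N} g fzero g≡0 =
  trans (sumFin-suc g) (trans (cong (g fzero +_) (sumFin-zero (g ∘ fsuc) λ x → g≡0 (fsuc x) λ ())) (+-identityʳ _))
sumFin-single {suc N} g (fsuc v) g≡0 =
  trans (sumFin-suc g) (cong₂ _+_ (g≡0 fzero λ ()) (sumFin-single (g ∘ fsuc) v λ x x≢v → g≡0 (fsuc x) (x≢v ∘ suc-injective)))

sumFin-update : ∀ {N} (g h : Fin N → ℕ) (v : Fin N) → (∀ x → x ≢ v → g x ≡ h x) →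
  sumFin g + h v ≡ sumFin h + g v
sumFin-update {suc N} g h fzero g≡h = begin
  sumFin g + h fzero                      ≡⟨ cong (_+ h fzero) (sumFin-suc g) ⟩
  g fzero + sumFin (g ∘ fsuc) + h fzero   ≡⟨ cong (λ z → g fzero + z + h fzero) (sumFin-cong λ x → g≡h (fsuc x) λ ()) ⟩
  g fzero + sumFin (h ∘ fsuc) + h fzero   ≡⟨ swap (g fzero) (sumFin (h ∘ fsuc)) (h fzero) ⟩
  h fzero + sumFin (h ∘ fsuc) + g fzero   ≡⟨ cong (_+ g fzero) (sym (sumFin-suc h)) ⟩
  sumFin h + g fzero                      ∎
  where
  open ≡-Reasoning
  open +-*-Solver
  swap : ∀ a b c → a + b + c ≡ c + b + a
  swap = solve 3 (λ a b c → a :+ b :+ c := c :+ b :+ a) refl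
sumFin-update {suc N} g h (fsuc v) g≡h = begin
  sumFin g + h (fsuc v)                         ≡⟨ cong (_+ h (fsuc v)) (sumFin-suc g) ⟩
  g fzero + sumFin (g ∘ fsuc) + h (fsuc v)      ≡⟨ +-assoc (g fzero) _ _ ⟩
  g fzero + (sumFin (g ∘ fsuc) + h (fsuc v))    ≡⟨ cong₂ _+_ (g≡h fzero λ ()) (sumFin-update (g ∘ fsuc) (h ∘ fsuc) v
                                                      λ x x≢v → g≡h (fsuc x) (x≢v ∘ suc-injective)) ⟩
  h fzero + (sumFin (h ∘ fsuc) + g (fsuc v))    ≡⟨ sym (+-assoc (h fzero) _ _) ⟩
  h fzero + sumFin (h ∘ fsuc) + g (fsuc v)      ≡⟨ cong (_+ g (fsuc v)) (sym (sumFin-suc h)) ⟩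
  sumFin h + g (fsuc v)                         ∎
  where open ≡-Reasoning

≤-sumFin : ∀ {N} (g : Fin N → ℕ) v → g v ≤ sumFin g
≤-sumFin {suc N} g fzero = subst (g fzero ≤_) (sym (sumFin-suc g)) (m≤m+n _ _)
≤-sumFin {suc N} g (fsuc v) = subst (g (fsuc v) ≤_) (sym (sumFin-suc g)) (≤-trans (≤-sumFin (g ∘ fsuc) v) (m≤n+m _ _))


-- Words with prescribed letter counts

module Occurrences {A : Set} (_≟ᴬ_ : DecidableEquality A) where

  occ : A → List A → ℕ
  occ a [] = 0
  occ a (x ∷ xs) with a ≟ᴬ x
  ... | yes _ = suc (occ a xs)
  ... | no _ = occ a xs

  removeAll : A → List A → List A
  removeAll a [] = []
  removeAll a (x ∷ xs) with a ≟ᴬ x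
  ... | yes _ = removeAll a xs
  ... | no _ = x ∷ removeAll a xs

  occ-here : ∀ a xs → occ a (a ∷ xs) ≡ suc (occ a xs)
  occ-here a xs with a ≟ᴬ a
  ... | yes _ = refl
  ... | no a≢a = ⊥-elim (a≢a refl)

  occ-there : ∀ {a x} xs → a ≢ x → occ a (x ∷ xs) ≡ occ a xs
  occ-there {a} {x} xs a≢x with a ≟ᴬ x
  ... | yes a≡x = ⊥-elim (a≢x a≡x)
  ... | no _ = refl

  occ-++ : ∀ a xs ys → occ a (xs ++ ys) ≡ occ a xs + occ a ys
  occ-++ a [] ys = refl
  occ-++ a (x ∷ xs) ys with a ≟ᴬ x
  ... | yes _ = cong suc (occ-++ a xs ys)
  ... | no _ = occ-++ a xs ys

  occ-∉ : ∀ {a} xs → a ∉ xs → occ a xs ≡ 0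
  occ-∉ [] _ = refl
  occ-∉ {a} (x ∷ xs) a∉ with a ≟ᴬ x
  ... | yes refl = ⊥-elim (a∉ (here refl))
  ... | no _ = occ-∉ xs (a∉ ∘ there)

  occ-replicate : ∀ a c → occ a (replicate c a) ≡ c
  occ-replicate a zero = refl
  occ-replicate a (suc c) = trans (occ-here a (replicate c a)) (cong suc (occ-replicate a c))

  occ-unique : ∀ {a} xs → Unique xs → a ∈ xs → occ a xs ≡ 1
  occ-unique (x ∷ xs) (x∉xs ∷ _) (here refl) =
    trans (occ-here x xs) (cong suc (occ-∉ xs λ x∈xs → All.lookup x∉xs x∈xs refl))
  occ-unique (x ∷ xs) (x∉xs ∷ xs!) (there a∈xs) =
    trans (occ-there xs λ a≡x → All.lookup x∉xs a∈xs (sym a≡x)) (occ-unique xs xs! a∈xs)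

  removeAll-here : ∀ a xs → removeAll a (a ∷ xs) ≡ removeAll a xs
  removeAll-here a xs with a ≟ᴬ a
  ... | yes _ = refl
  ... | no a≢a = ⊥-elim (a≢a refl)

  removeAll-∉ : ∀ {a} xs → a ∉ xs → removeAll a xs ≡ xs
  removeAll-∉ [] _ = refl
  removeAll-∉ {a} (x ∷ xs) a∉ with a ≟ᴬ x
  ... | yes refl = ⊥-elim (a∉ (here refl))
  ... | no _ = cong (x ∷_) (removeAll-∉ xs (a∉ ∘ there))

  removeAll-replicate : ∀ a c → removeAll a (replicate c a) ≡ []
  removeAll-replicate a zero = refl
  removeAll-replicate a (suc c) = trans (removeAll-here a (replicate c a)) (removeAll-replicate a c)

  ∈-removeAll⁻ : ∀ {a y} xs → y ∈ removeAll a xs → y ∈ xs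
  ∈-removeAll⁻ {a} (x ∷ xs) p with a ≟ᴬ x
  ∈-removeAll⁻ (x ∷ xs) p         | yes _ = there (∈-removeAll⁻ xs p)
  ∈-removeAll⁻ (x ∷ xs) (here eq) | no _ = here eq
  ∈-removeAll⁻ (x ∷ xs) (there p) | no _ = there (∈-removeAll⁻ xs p)

  ∈-removeAll⁺ : ∀ {a y} xs → y ∈ xs → y ≢ a → y ∈ removeAll a xs
  ∈-removeAll⁺ {a} (x ∷ xs) p y≢a with a ≟ᴬ x
  ∈-removeAll⁺ (x ∷ xs) (here refl) y≢a | yes refl = ⊥-elim (y≢a refl)
  ∈-removeAll⁺ (x ∷ xs) (there p)   y≢a | yes _ = ∈-removeAll⁺ xs p y≢a
  ∈-removeAll⁺ (x ∷ xs) (here eq)   y≢a | no _ = here eq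
  ∈-removeAll⁺ (x ∷ xs) (there p)   y≢a | no _ = there (∈-removeAll⁺ xs p y≢a)

  ∉-removeAll : ∀ a xs → a ∉ removeAll a xs
  ∉-removeAll a (x ∷ xs) p with a ≟ᴬ x
  ∉-removeAll a (x ∷ xs) p         | yes _ = ∉-removeAll a xs p
  ∉-removeAll a (x ∷ xs) (here eq) | no a≢x = a≢x eq
  ∉-removeAll a (x ∷ xs) (there p) | no _ = ∉-removeAll a xs p

  occ-removeAll : ∀ {a b} xs → b ≢ a → occ b (removeAll a xs) ≡ occ b xs
  occ-removeAll [] _ = refl
  occ-removeAll {a} {b} (x ∷ xs) b≢a with a ≟ᴬ x | b ≟ᴬ x
  ... | yes refl | yes refl = ⊥-elim (b≢a refl)
  ... | yes refl | no _ = occ-removeAll xs b≢a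
  ... | no _ | yes refl = trans (occ-here b (removeAll a xs)) (cong suc (occ-removeAll xs b≢a))
  ... | no _ | no b≢x = trans (occ-there (removeAll a xs) b≢x) (occ-removeAll xs b≢a)

  length-≡-sum-occ : ∀ E → Unique E → ∀ xs → All (_∈ E) xs → length xs ≡ sum (map (λ e → occ e xs) E)
  length-≡-sum-occ E E! [] _ = sym (sum-zeros E)
    where
    sum-zeros : ∀ E → sum (map (λ e → occ e []) E) ≡ 0
    sum-zeros [] = refl
    sum-zeros (_ ∷ E) = sum-zeros E
  length-≡-sum-occ E E! (y ∷ xs) (y∈E ∷ xs⊆E) =
    trans (cong suc (length-≡-sum-occ E E! xs xs⊆E)) (sym (sum-occ-∷ E E! y∈E))
    where
    sum-occ-∷ : ∀ E → Unique E → y ∈ E → sum (map (λ e → occ e (y ∷ xs)) E) ≡ suc (sum (map (λ e → occ e xs) E))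
    sum-occ-∷ (e ∷ E) (e∉E ∷ _) (here refl) =
      cong₂ _+_ (occ-here e xs) (sum-map-cong E λ e′∈E → occ-there xs λ e′≡e → All.lookup e∉E e′∈E (sym e′≡e))
    sum-occ-∷ (e ∷ E) (e∉E ∷ E!) (there y∈E) =
      trans (cong₂ _+_ (occ-there xs λ e≡y → All.lookup e∉E y∈E e≡y) (sum-occ-∷ E E! y∈E)) (+-suc _ _)

  occ-moveToEnd : ∀ {e} p xs → Unique xs → e ∈ xs → occ e (removeAll p xs ++ [ p ]) ≡ 1
  occ-moveToEnd {e} p xs xs! e∈xs with e ≟ᴬ p
  ... | yes refl = begin
    occ e (removeAll e xs ++ [ e ])        ≡⟨ occ-++ e (removeAll e xs) [ e ] ⟩
    occ e (removeAll e xs) + occ e [ e ]   ≡⟨ cong₂ _+_ (occ-∉ _ (∉-removeAll e xs)) (occ-here e []) ⟩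
    1                                      ∎
    where open ≡-Reasoning
  ... | no e≢p = begin
    occ e (removeAll p xs ++ [ p ])        ≡⟨ occ-++ e (removeAll p xs) [ p ] ⟩
    occ e (removeAll p xs) + occ e [ p ]   ≡⟨ cong₂ _+_ (occ-removeAll xs e≢p) (occ-there [] e≢p) ⟩
    occ e xs + 0                           ≡⟨ +-identityʳ _ ⟩
    occ e xs                               ≡⟨ occ-unique xs xs! e∈xs ⟩
    1                                      ∎
    where open ≡-Reasoning

module Arrangements {A : Set} (_≟ᴬ_ : DecidableEquality A) where

  open Occurrences _≟ᴬ_ public

  insertions : ℕ → A → List A → List (List A)
  insertions zero a w = [ w ]
  insertions (suc c) a [] = [ replicate (suc c) a ]
  insertions (suc c) a (b ∷ w) = map (a ∷_) (insertions c a (b ∷ w)) ++ map (b ∷_) (insertions (suc c) a w)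

  arrangements : List A → (A → ℕ) → List (List A)
  arrangements [] k = [ [] ]
  arrangements (a ∷ as) k = concatMap (insertions (k a) a) (arrangements as k)

  length-insertions : ∀ c a w → length (insertions c a w) ≡ (c + length w) C c
  length-insertions zero a w = refl
  length-insertions (suc c) a [] = trans (sym (nCn≡1 (suc c))) (cong (_C suc c) (sym (+-identityʳ (suc c))))
  length-insertions (suc c) a (b ∷ w) = begin
    length (map (a ∷_) (insertions c a (b ∷ w)) ++ map (b ∷_) (insertions (suc c) a w))
      ≡⟨ length-++ (map (a ∷_) (insertions c a (b ∷ w))) ⟩
    length (map (a ∷_) (insertions c a (b ∷ w))) + length (map (b ∷_) (insertions (suc c) a w))
      ≡⟨ cong₂ _+_ (trans (length-map (a ∷_) (insertions c a (b ∷ w))) (length-insertions c a (b ∷ w)))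
                   (trans (length-map (b ∷_) (insertions (suc c) a w)) (length-insertions (suc c) a w)) ⟩
    (c + suc (length w)) C c + (suc c + length w) C suc c
      ≡⟨ cong (λ z → (c + suc (length w)) C c + z C suc c) (sym (+-suc c (length w))) ⟩
    (c + suc (length w)) C c + (c + suc (length w)) C suc c
      ≡⟨ nCk+nC[k+1]≡[n+1]C[k+1] (c + suc (length w)) c ⟩
    (suc c + suc (length w)) C suc c ∎
    where open ≡-Reasoning

  ∈-insertions-removeAll : ∀ a w → w ∈ insertions (occ a w) a (removeAll a w)
  ∈-insertions-removeAll a [] = here refl
  ∈-insertions-removeAll a (x ∷ w) with a ≟ᴬ x
  ... | yes refl = prependA (removeAll a w) (∈-insertions-removeAll a w)
    where
    prependA : ∀ r → w ∈ insertions (occ a w) a r → (a ∷ w) ∈ insertions (suc (occ a w)) a r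
    prependA [] w∈ with occ a w | w∈
    ... | zero  | here refl = here refl
    ... | suc _ | here refl = here refl
    prependA (b ∷ r) w∈ = ∈-++⁺ˡ (∈-map⁺ (a ∷_) w∈)
  ... | no _ = prependX (occ a w) (removeAll a w) (∈-insertions-removeAll a w)
    where
    prependX : ∀ c r → w ∈ insertions c a r → (x ∷ w) ∈ insertions c a (x ∷ r)
    prependX zero r (here refl) = here refl
    prependX (suc c) r w∈ = ∈-++⁺ʳ _ (∈-map⁺ (x ∷_) w∈)

  ∈-insertions⁻ : ∀ c a w {v} → v ∈ insertions c a w →
    length v ≡ c + length w × occ a v ≡ c + occ a w × removeAll a v ≡ removeAll a w
  ∈-insertions⁻ zero a w (here refl) = refl , refl , refl
  ∈-insertions⁻ (suc c) a [] (here refl) =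
    trans (length-replicate (suc c)) (sym (+-identityʳ (suc c))) ,
    trans (occ-replicate a (suc c)) (sym (+-identityʳ (suc c))) ,
    removeAll-replicate a (suc c)
  ∈-insertions⁻ (suc c) a (b ∷ w) p with ∈-++⁻ (map (a ∷_) (insertions c a (b ∷ w))) p
  ... | inj₁ q with ∈-map⁻ (a ∷_) q
  ... | t , t∈ , refl with ∈-insertions⁻ c a (b ∷ w) t∈
  ... | len , #a , rest = cong suc len , trans (occ-here a t) (cong suc #a) , trans (removeAll-here a t) rest
  ∈-insertions⁻ (suc c) a (b ∷ w) p | inj₂ q with ∈-map⁻ (b ∷_) q
  ... | t , t∈ , refl with ∈-insertions⁻ (suc c) a w t∈ | a ≟ᴬ b
  ... | len , #a , rest | yes _ =
    trans (cong suc len) (sym (+-suc (suc c) (length w))) , trans (cong suc #a) (sym (+-suc (suc c) _)) , rest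
  ... | len , #a , rest | no _ =
    trans (cong suc len) (sym (+-suc (suc c) (length w))) , #a , cong (b ∷_) rest

  insertions-unique : ∀ c a w → a ∉ w → Unique (insertions c a w)
  insertions-unique zero a w _ = [] ∷ []
  insertions-unique (suc c) a [] _ = [] ∷ []
  insertions-unique (suc c) a (b ∷ w) a∉ =
    Unique.++⁺ (Unique.map⁺ ∷-injectiveʳ (insertions-unique c a (b ∷ w) a∉))
               (Unique.map⁺ ∷-injectiveʳ (insertions-unique (suc c) a w (a∉ ∘ there)))
      λ { (p , q) → differentHeads (∈-map⁻ _ p) (∈-map⁻ _ q) }
    where
    differentHeads : ∀ {v} → (∃ λ t → t ∈ insertions c a (b ∷ w) × v ≡ a ∷ t) →
                     (∃ λ t → t ∈ insertions (suc c) a w × v ≡ b ∷ t) → ⊥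
    differentHeads (_ , _ , refl) (_ , _ , refl) = a∉ (here refl)

  ∈-arrangements⁻ : ∀ as k {v} → v ∈ arrangements as k → length v ≡ sum (map k as) × All (_∈ as) v
  ∈-arrangements⁻ [] k (here refl) = refl , []
  ∈-arrangements⁻ (a ∷ as) k p with find (∈-concatMap⁻ (insertions (k a) a) {xs = arrangements as k} p)
  ... | t , t∈ , q with ∈-insertions⁻ (k a) a t q | ∈-arrangements⁻ as k t∈
  ... | len , _ , rest | lenₜ , t⊆as = trans len (cong (k a +_) lenₜ) , All.tabulate letter
    where
    letter : ∀ {y} → y ∈ _ → y ∈ a ∷ as
    letter {y} y∈ with y ≟ᴬ a
    ... | yes refl = here refl
    ... | no y≢a = there (All.lookup t⊆as (∈-removeAll⁻ t (subst (y ∈_) rest (∈-removeAll⁺ _ y∈ y≢a))))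

  private
    ∉-arrangements : ∀ {a as k t} → a ∉ as → t ∈ arrangements as k → a ∉ t
    ∉-arrangements a∉as t∈ a∈t = a∉as (All.lookup (proj₂ (∈-arrangements⁻ _ _ t∈)) a∈t)

  occ-∈-arrangements : ∀ as k → Unique as → ∀ {v} → v ∈ arrangements as k → ∀ {b} → b ∈ as → occ b v ≡ k b
  occ-∈-arrangements (a ∷ as) k (a∉as ∷ as!) {v} p {b} b∈
    with find (∈-concatMap⁻ (insertions (k a) a) {xs = arrangements as k} p)
  ... | t , t∈ , q with ∈-insertions⁻ (k a) a t q | b∈
  ... | _ , #a , _ | here refl =
    trans #a (trans (cong (k a +_) (occ-∉ t (∉-arrangements (λ a∈as → All.lookup a∉as a∈as refl) t∈))) (+-identityʳ _))
  ... | _ , _ , rest | there b∈as = begin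
    occ b v                 ≡⟨ sym (occ-removeAll v b≢a) ⟩
    occ b (removeAll a v)   ≡⟨ cong (occ b) rest ⟩
    occ b (removeAll a t)   ≡⟨ occ-removeAll t b≢a ⟩
    occ b t                 ≡⟨ occ-∈-arrangements as k as! t∈ b∈as ⟩
    k b                     ∎
    where
    open ≡-Reasoning
    b≢a : b ≢ a
    b≢a b≡a = All.lookup a∉as b∈as (sym b≡a)

  arrangements-unique : ∀ as k → Unique as → Unique (arrangements as k)
  arrangements-unique [] k _ = [] ∷ []
  arrangements-unique (a ∷ as) k (a∉as ∷ as!) =
    unique-concatMap⁺ (insertions (k a) a) (arrangements as k) (arrangements-unique as k as!)
      (λ t∈ → insertions-unique (k a) a _ (∉-arrangements a∉as′ t∈))
      λ {t₁} {t₂} {v} t₁∈ t₂∈ p q → begin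
        t₁                 ≡⟨ sym (removeAll-∉ t₁ (∉-arrangements a∉as′ t₁∈)) ⟩
        removeAll a t₁     ≡⟨ sym (proj₂ (proj₂ (∈-insertions⁻ (k a) a t₁ p))) ⟩
        removeAll a v      ≡⟨ proj₂ (proj₂ (∈-insertions⁻ (k a) a t₂ q)) ⟩
        removeAll a t₂     ≡⟨ removeAll-∉ t₂ (∉-arrangements a∉as′ t₂∈) ⟩
        t₂                 ∎
    where
    open ≡-Reasoning
    a∉as′ : a ∉ as
    a∉as′ a∈as = All.lookup a∉as a∈as refl

  length-arrangements : ∀ as k → length (arrangements as k) ≡ multinomial (map k as)
  length-arrangements [] k = refl
  length-arrangements (a ∷ as) k = begin
    length (concatMap (insertions (k a) a) (arrangements as k))
      ≡⟨ length-concatMap-const (insertions (k a) a) B (arrangements as k)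
           (λ {t} t∈ → trans (length-insertions (k a) a t) (cong (λ z → (k a + z) C k a) (proj₁ (∈-arrangements⁻ as k t∈)))) ⟩
    length (arrangements as k) * B       ≡⟨ *-comm (length (arrangements as k)) B ⟩
    B * length (arrangements as k)       ≡⟨ cong (B *_) (length-arrangements as k) ⟩
    B * multinomial (map k as)           ≡⟨ sym (multinomial-∷ (k a) (map k as)) ⟩
    multinomial (k a ∷ map k as)         ∎
    where
    open ≡-Reasoning
    B = (k a + sum (map k as)) C k a

  ∈-arrangements⁺ : ∀ as k → Unique as → ∀ w → All (_∈ as) w → (∀ {b} → b ∈ as → occ b w ≡ k b) →
    w ∈ arrangements as k
  ∈-arrangements⁺ [] k _ [] _ _ = here refl
  ∈-arrangements⁺ [] k _ (y ∷ w) (() ∷ _) _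
  ∈-arrangements⁺ (a ∷ as) k (a∉as ∷ as!) w w⊆ #w =
    ∈-concatMap⁺ (insertions (k a) a) {xs = arrangements as k}
      (Any.map (λ { refl → subst (λ c → w ∈ insertions c a (removeAll a w)) (#w (here refl)) (∈-insertions-removeAll a w) })
        (∈-arrangements⁺ as k as! (removeAll a w) rest⊆ #rest))
    where
    rest⊆ : All (_∈ as) (removeAll a w)
    rest⊆ = All.tabulate λ {y} y∈ → letter y∈ (All.lookup w⊆ (∈-removeAll⁻ w y∈))
      where
      letter : ∀ {y} → y ∈ removeAll a w → y ∈ a ∷ as → y ∈ as
      letter y∈ (here refl) = ⊥-elim (∉-removeAll a w y∈)
      letter _ (there y∈as) = y∈as
    #rest : ∀ {b} → b ∈ as → occ b (removeAll a w) ≡ k b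
    #rest {b} b∈as = trans (occ-removeAll w λ b≡a → All.lookup a∉as b∈as (sym b≡a)) (#w (there b∈as))

-- Walks and their exit lists

indicator : Bool → ℕ
indicator b = if b then 1 else 0

isStep-self : ∀ {m} (e : Fin m) d → isStep e d (e , d) ≡ true
isStep-self e d with e ≟ e
... | no e≢e = ⊥-elim (e≢e refl)
isStep-self e true  | yes _ = refl
isStep-self e false | yes _ = refl

isStep-other : ∀ {m} (e : Fin m) d st → st ≢ (e , d) → isStep e d st ≡ false
isStep-other e d (e′ , d′) st≢ with e ≟ e′
... | no _ = refl
isStep-other e true  (e′ , true)  st≢ | yes refl = ⊥-elim (st≢ refl)
isStep-other e true  (e′ , false) st≢ | yes refl = refl
isStep-other e false (e′ , true)  st≢ | yes refl = refl
isStep-other e false (e′ , false) st≢ | yes refl = ⊥-elim (st≢ refl)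

step-counted-once : ∀ {m} (st : Step m) →
  sumFin (λ e → indicator (isStep e true st) + indicator (isStep e false st)) ≡ 1
step-counted-once (e₀ , d₀) =
  trans (sumFin-single _ e₀ λ e e≢e₀ → cong₂ _+_ (unmatched e e≢e₀ true) (unmatched e e≢e₀ false)) (matched d₀)
  where
  unmatched : ∀ e → e ≢ e₀ → ∀ d → indicator (isStep e d (e₀ , d₀)) ≡ 0
  unmatched e e≢e₀ d = cong indicator (isStep-other e d (e₀ , d₀) λ eq → e≢e₀ (sym (cong proj₁ eq)))
  matched : ∀ d₀ → indicator (isStep e₀ true (e₀ , d₀)) + indicator (isStep e₀ false (e₀ , d₀)) ≡ 1
  matched true  = cong₂ _+_ (cong indicator (isStep-self e₀ true)) (cong indicator (isStep-other e₀ false _ λ ()))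
  matched false = cong₂ _+_ (cong indicator (isStep-other e₀ true _ λ ())) (cong indicator (isStep-self e₀ false))

length-≡-sum-traversals : ∀ {m} (ss : List (Step m)) →
  length ss ≡ sumFin (λ e → traversals e true ss + traversals e false ss)
length-≡-sum-traversals {m} [] = sym (sumFin-zero {m} (λ e → traversals e true [] + traversals e false []) λ _ → refl)
length-≡-sum-traversals {m} (st ∷ ss) = begin
  suc (length ss)                 ≡⟨ cong suc (length-≡-sum-traversals ss) ⟩
  1 + sumFin rest                 ≡⟨ cong (_+ sumFin rest) (sym (step-counted-once st)) ⟩
  sumFin once + sumFin rest       ≡⟨ sym (sum-map-+ {f = once} {g = rest} (allFin m)) ⟩
  sumFin (λ e → once e + rest e)  ≡⟨ sumFin-cong (λ e → interchange (a e) (b e) (t e) (f e)) ⟩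
  sumFin (λ e → traversals e true (st ∷ ss) + traversals e false (st ∷ ss)) ∎
  where
  open ≡-Reasoning
  a b t f once rest : Fin m → ℕ
  a e = indicator (isStep e true st)
  b e = indicator (isStep e false st)
  t e = traversals e true ss
  f e = traversals e false ss
  once e = a e + b e
  rest e = t e + f e
  open +-*-Solver
  interchange : ∀ a b t f → a + b + (t + f) ≡ a + t + (b + f)
  interchange = solve 4 (λ a b t f → a :+ b :+ (t :+ f) := a :+ t :+ (b :+ f)) refl

∈-allSteps : ∀ {m} (st : Step m) → st ∈ allSteps m
∈-allSteps {m} (e , d) =
  ∈-concatMap⁺ (λ e → (e , true) ∷ (e , false) ∷ []) {xs = allFin m} (Any.map (λ { refl → bothDirections d }) (∈-allFin e))
  where
  bothDirections : ∀ d → (e , d) ∈ (e , true) ∷ (e , false) ∷ []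
  bothDirections true = here refl
  bothDirections false = there (here refl)

allSteps-unique : ∀ m → Unique (allSteps m)
allSteps-unique m = unique-concatMap⁺ (λ e → (e , true) ∷ (e , false) ∷ []) (allFin m) (Unique.allFin⁺ m)
  (λ _ → ((λ ()) ∷ []) ∷ ([] ∷ []))
  λ _ _ p q → trans (sym (edgeOf p)) (edgeOf q)
  where
  edgeOf : ∀ {e st} → st ∈ (e , true) ∷ (e , false) ∷ [] → proj₁ st ≡ e
  edgeOf (here refl) = refl
  edgeOf (there (here refl)) = refl

module Loopless {n m} (G : Graph n m) (loopless : ∀ e → proj₁ (ends G e) ≢ proj₂ (ends G e)) where

  open Arrangements {Fin m} _≟_

  Incident : Fin n → Fin m → Set
  Incident v e = proj₁ (ends G e) ≡ v ⊎ proj₂ (ends G e) ≡ v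

  ∈-incidentEdges⁺ : ∀ {v e} → Incident v e → e ∈ incidentEdges G v
  ∈-incidentEdges⁺ {v} {e} v∼e = ∈-filter⁺ (λ e → T? (incident? G v e)) (∈-allFin e) (isIncident v∼e)
    where
    isIncident : Incident v e → T (incident? G v e)
    isIncident v∼e with proj₁ (ends G e) ≟ v | proj₂ (ends G e) ≟ v
    ... | yes _ | _ = _
    ... | no _ | yes _ = _
    ... | no ¬fst | no ¬snd with v∼e
    ...   | inj₁ fst = ¬fst fst
    ...   | inj₂ snd = ¬snd snd

  ∈-incidentEdges⁻ : ∀ {v e} → e ∈ incidentEdges G v → Incident v e
  ∈-incidentEdges⁻ {v} {e} e∈ = incident (proj₂ (∈-filter⁻ (λ e → T? (incident? G v e)) {xs = allFin m} e∈))
    where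
    incident : T (incident? G v e) → Incident v e
    incident _ with proj₁ (ends G e) ≟ v | proj₂ (ends G e) ≟ v
    ... | yes fst | _ = inj₁ fst
    ... | no _ | yes snd = inj₂ snd

  incidentEdges-unique : ∀ v → Unique (incidentEdges G v)
  incidentEdges-unique v = Unique.filter⁺ (λ e → T? (incident? G v e)) (Unique.allFin⁺ m)

  tail-incident : ∀ {v} st → tail G st ≡ v → Incident v (proj₁ st)
  tail-incident (e , true)  = inj₁
  tail-incident (e , false) = inj₂

  head-incident : ∀ {v} st → head G st ≡ v → Incident v (proj₁ st)
  head-incident (e , true)  = inj₂
  head-incident (e , false) = inj₁

  direction : Fin m → Fin n → Bool
  direction e v with proj₁ (ends G e) ≟ v
  ... | yes _ = true
  ... | no _ = false

  exitStep : Fin n → Fin m → Step m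
  exitStep v e = e , direction e v

  opposite : Fin m → Fin n → Fin n
  opposite e v with proj₁ (ends G e) ≟ v
  ... | yes _ = proj₂ (ends G e)
  ... | no _ = proj₁ (ends G e)

  direction-fst : ∀ e → direction e (proj₁ (ends G e)) ≡ true
  direction-fst e with proj₁ (ends G e) ≟ proj₁ (ends G e)
  ... | yes _ = refl
  ... | no ¬eq = ⊥-elim (¬eq refl)

  direction-snd : ∀ e → direction e (proj₂ (ends G e)) ≡ false
  direction-snd e with proj₁ (ends G e) ≟ proj₂ (ends G e)
  ... | yes loop = ⊥-elim (loopless e loop)
  ... | no _ = refl

  exitStep-tail : ∀ {v} st → tail G st ≡ v → exitStep v (proj₁ st) ≡ st
  exitStep-tail {v} (e , true) tail≡v with proj₁ (ends G e) ≟ v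
  ... | yes _ = refl
  ... | no ¬eq = ⊥-elim (¬eq tail≡v)
  exitStep-tail {v} (e , false) tail≡v with proj₁ (ends G e) ≟ v
  ... | yes fst = ⊥-elim (loopless e (trans fst (sym tail≡v)))
  ... | no _ = refl

  tail-exitStep : ∀ {v e} → Incident v e → tail G (exitStep v e) ≡ v
  tail-exitStep {v} {e} v∼e with proj₁ (ends G e) ≟ v
  ... | yes fst = fst
  ... | no ¬eq with v∼e
  ...   | inj₁ fst = ⊥-elim (¬eq fst)
  ...   | inj₂ snd = snd

  opposite-incident : ∀ {v e} → Incident v e → Incident (opposite e v) e
  opposite-incident {v} {e} _ with proj₁ (ends G e) ≟ v
  ... | yes _ = inj₂ refl
  ... | no _ = inj₁ refl

  opposite-opposite : ∀ {v e} → Incident v e → opposite e (opposite e v) ≡ v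
  opposite-opposite {v} {e} v∼e with proj₁ (ends G e) ≟ v
  opposite-opposite {v} {e} v∼e | yes fst with proj₁ (ends G e) ≟ proj₂ (ends G e)
  ... | yes loop = ⊥-elim (loopless e loop)
  ... | no _ = fst
  opposite-opposite {v} {e} v∼e | no ¬fst with proj₁ (ends G e) ≟ proj₁ (ends G e)
  ... | no ¬eq = ⊥-elim (¬eq refl)
  ... | yes _ with v∼e
  ...   | inj₁ fst = ⊥-elim (¬fst fst)
  ...   | inj₂ snd = snd

  head-≡-opposite : ∀ {v} st → tail G st ≡ v → head G st ≡ opposite (proj₁ st) v
  head-≡-opposite {v} (e , true) tail≡v with proj₁ (ends G e) ≟ v
  ... | yes _ = refl
  ... | no ¬eq = ⊥-elim (¬eq tail≡v)
  head-≡-opposite {v} (e , false) tail≡v with proj₁ (ends G e) ≟ v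
  ... | yes fst = ⊥-elim (loopless e (trans fst (sym tail≡v)))
  ... | no _ = refl

  head≡⇒tail≡opposite : ∀ {x} st → head G st ≡ x → tail G st ≡ opposite (proj₁ st) x
  head≡⇒tail≡opposite {x} (e , true) head≡x with proj₁ (ends G e) ≟ x
  ... | yes fst = ⊥-elim (loopless e (trans fst (sym head≡x)))
  ... | no _ = refl
  head≡⇒tail≡opposite {x} (e , false) head≡x with proj₁ (ends G e) ≟ x
  ... | yes _ = refl
  ... | no ¬eq = ⊥-elim (¬eq head≡x)

  tail≡opposite⇒head≡ : ∀ {x} st → Incident x (proj₁ st) → tail G st ≡ opposite (proj₁ st) x → head G st ≡ x
  tail≡opposite⇒head≡ {x} (e , true) x∼e tail≡ with proj₁ (ends G e) ≟ x
  ... | yes _ = ⊥-elim (loopless e tail≡)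
  ... | no ¬fst with x∼e
  ...   | inj₁ fst = ⊥-elim (¬fst fst)
  ...   | inj₂ snd = snd
  tail≡opposite⇒head≡ {x} (e , false) x∼e tail≡ with proj₁ (ends G e) ≟ x
  ... | yes fst = fst
  ... | no _ = ⊥-elim (loopless e (sym tail≡))

  exits : Fin n → List (Step m) → List (Fin m)
  exits v [] = []
  exits v (st ∷ ss) with tail G st ≟ v
  ... | yes _ = proj₁ st ∷ exits v ss
  ... | no _ = exits v ss

  entries : Fin n → List (Step m) → List (Fin m)
  entries v [] = []
  entries v (st ∷ ss) with head G st ≟ v
  ... | yes _ = proj₁ st ∷ entries v ss
  ... | no _ = entries v ss

  exits-∷-≡ : ∀ {v} st ss → tail G st ≡ v → exits v (st ∷ ss) ≡ proj₁ st ∷ exits v ss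
  exits-∷-≡ {v} st ss tail≡v with tail G st ≟ v
  ... | yes _ = refl
  ... | no ¬eq = ⊥-elim (¬eq tail≡v)

  exits-∷-≢ : ∀ {v} st ss → tail G st ≢ v → exits v (st ∷ ss) ≡ exits v ss
  exits-∷-≢ {v} st ss tail≢v with tail G st ≟ v
  ... | yes eq = ⊥-elim (tail≢v eq)
  ... | no _ = refl

  entries-∷-≡ : ∀ {v} st ss → head G st ≡ v → entries v (st ∷ ss) ≡ proj₁ st ∷ entries v ss
  entries-∷-≡ {v} st ss head≡v with head G st ≟ v
  ... | yes _ = refl
  ... | no ¬eq = ⊥-elim (¬eq head≡v)

  entries-∷-≢ : ∀ {v} st ss → head G st ≢ v → entries v (st ∷ ss) ≡ entries v ss
  entries-∷-≢ {v} st ss head≢v with head G st ≟ v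
  ... | yes eq = ⊥-elim (head≢v eq)
  ... | no _ = refl

  exits-incident : ∀ v ss → All (Incident v) (exits v ss)
  exits-incident v [] = []
  exits-incident v (st ∷ ss) with tail G st ≟ v
  ... | yes tail≡v = tail-incident st tail≡v ∷ exits-incident v ss
  ... | no _ = exits-incident v ss

  entries-incident : ∀ v ss → All (Incident v) (entries v ss)
  entries-incident v [] = []
  entries-incident v (st ∷ ss) with head G st ≟ v
  ... | yes head≡v = head-incident st head≡v ∷ entries-incident v ss
  ... | no _ = entries-incident v ss

  occ-exits : ∀ {v e} → Incident v e → ∀ ss → occ e (exits v ss) ≡ traversals e (direction e v) ss
  occ-exits v∼e [] = refl
  occ-exits {v} {e} v∼e (st ∷ ss) with tail G st ≟ v
  ... | yes tail≡v = trans (occ-++ e [ proj₁ st ] (exits v ss)) (cong₂ _+_ (counted st tail≡v) (occ-exits v∼e ss))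
    where
    counted : ∀ st → tail G st ≡ v → occ e [ proj₁ st ] ≡ indicator (isStep e (direction e v) st)
    counted (e′ , d) tail≡v with e ≟ e′ | cong proj₂ (exitStep-tail (e′ , d) tail≡v)
    ... | no _    | _ = refl
    ... | yes refl | refl with d
    ...   | true  = refl
    ...   | false = refl
  ... | no tail≢v = trans (occ-exits v∼e ss) (cong (λ b → indicator b + traversals e (direction e v) ss)
        (sym (isStep-other e (direction e v) st λ st≡ → tail≢v (trans (cong (tail G) st≡) (tail-exitStep v∼e)))))

  traversals-true : ∀ e ss → traversals e true ss ≡ occ e (exits (proj₁ (ends G e)) ss)
  traversals-true e ss = trans (cong (λ d → traversals e d ss) (sym (direction-fst e))) (sym (occ-exits (inj₁ refl) ss))

  traversals-false : ∀ e ss → traversals e false ss ≡ occ e (exits (proj₂ (ends G e)) ss)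
  traversals-false e ss = trans (cong (λ d → traversals e d ss) (sym (direction-snd e))) (sym (occ-exits (inj₂ refl) ss))

  occ-entries : ∀ {x e} → Incident x e → ∀ ss → occ e (entries x ss) ≡ occ e (exits (opposite e x) ss)
  occ-entries x∼e [] = refl
  occ-entries {x} {e} x∼e (st ∷ ss) = byCases (head G st ≟ x) (tail G st ≟ opposite e x) (e ≟ proj₁ st)
    where
    ih = occ-entries x∼e ss
    byCases : Dec (head G st ≡ x) → Dec (tail G st ≡ opposite e x) → Dec (e ≡ proj₁ st) →
              occ e (entries x (st ∷ ss)) ≡ occ e (exits (opposite e x) (st ∷ ss))
    byCases (yes h) (yes t) _ rewrite entries-∷-≡ st ss h | exits-∷-≡ st ss t =
      trans (occ-++ e [ proj₁ st ] (entries x ss)) (trans (cong (occ e [ proj₁ st ] +_) ih) (sym (occ-++ e [ proj₁ st ] _)))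
    byCases (no h) (no t) _ rewrite entries-∷-≢ st ss h | exits-∷-≢ st ss t = ih
    byCases (yes h) (no t) (yes refl) = ⊥-elim (t (head≡⇒tail≡opposite st h))
    byCases (yes h) (no t) (no e≢) rewrite entries-∷-≡ st ss h | exits-∷-≢ st ss t = trans (occ-there _ e≢) ih
    byCases (no h) (yes t) (yes refl) = ⊥-elim (h (tail≡opposite⇒head≡ st x∼e t))
    byCases (no h) (yes t) (no e≢) rewrite entries-∷-≢ st ss h | exits-∷-≡ st ss t = trans ih (sym (occ-there _ e≢))

  δ : Fin n → Fin n → ℕ
  δ a b = indicator (does (a ≟ b))

  δ-refl : ∀ a → δ a a ≡ 1
  δ-refl a with a ≟ a
  ... | yes _ = refl
  ... | no ¬eq = ⊥-elim (¬eq refl)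

  δ-≢ : ∀ {a b} → a ≢ b → δ a b ≡ 0
  δ-≢ {a} {b} a≢b with a ≟ b
  ... | yes eq = ⊥-elim (a≢b eq)
  ... | no _ = refl

  exits-entries-balance : ∀ {v ss w} → IsWalk G v ss w → ∀ x →
    length (exits x ss) + δ w x ≡ length (entries x ss) + δ v x
  exits-entries-balance stop x = refl
  exits-entries-balance {v} {w = w} (step {s = st} {ss = ss} tail≡v walk) x = begin
    length (exits x (st ∷ ss)) + δ w x                ≡⟨ cong (_+ δ w x) (length-exits-∷ (tail G st ≟ x)) ⟩
    δ (tail G st) x + length (exits x ss) + δ w x     ≡⟨ +-assoc (δ (tail G st) x) _ _ ⟩
    δ (tail G st) x + (length (exits x ss) + δ w x)   ≡⟨ cong₂ _+_ (cong (λ z → δ z x) tail≡v) (exits-entries-balance walk x) ⟩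
    δ v x + (length (entries x ss) + δ (head G st) x) ≡⟨ swap (δ v x) (length (entries x ss)) (δ (head G st) x) ⟩
    δ (head G st) x + length (entries x ss) + δ v x   ≡⟨ cong (_+ δ v x) (sym (length-entries-∷ (head G st ≟ x))) ⟩
    length (entries x (st ∷ ss)) + δ v x              ∎
    where
    open ≡-Reasoning
    open +-*-Solver
    swap : ∀ a b c → a + (b + c) ≡ c + b + a
    swap = solve 3 (λ a b c → a :+ (b :+ c) := c :+ b :+ a) refl
    length-exits-∷ : Dec (tail G st ≡ x) → length (exits x (st ∷ ss)) ≡ δ (tail G st) x + length (exits x ss)
    length-exits-∷ (yes eq) rewrite exits-∷-≡ st ss eq | eq | δ-refl x = refl
    length-exits-∷ (no ¬eq) rewrite exits-∷-≢ st ss ¬eq | δ-≢ ¬eq = refl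
    length-entries-∷ : Dec (head G st ≡ x) → length (entries x (st ∷ ss)) ≡ δ (head G st) x + length (entries x ss)
    length-entries-∷ (yes eq) rewrite entries-∷-≡ st ss eq | eq | δ-refl x = refl
    length-entries-∷ (no ¬eq) rewrite entries-∷-≢ st ss ¬eq | δ-≢ ¬eq = refl

  ExitLists : Set
  ExitLists = Fin n → List (Fin m)

  update : ExitLists → Fin n → List (Fin m) → ExitLists
  update D v r x with x ≟ v
  ... | yes _ = r
  ... | no _ = D x

  update-≡ : ∀ D v r → update D v r v ≡ r
  update-≡ D v r with v ≟ v
  ... | yes _ = refl
  ... | no ¬eq = ⊥-elim (¬eq refl)

  update-≢ : ∀ D v r {x} → x ≢ v → update D v r x ≡ D x
  update-≢ D v r {x} x≢v with x ≟ v
  ... | yes eq = ⊥-elim (x≢v eq)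
  ... | no _ = refl

  mutual
    follow : ℕ → Fin n → ExitLists → List (Step m)
    follow zero v D = []
    follow (suc f) v D = followVia f v D (D v)

    followVia : ℕ → Fin n → ExitLists → List (Fin m) → List (Step m)
    followVia f v D [] = []
    followVia f v D (e ∷ r) = exitStep v e ∷ follow f (head G (exitStep v e)) (update D v r)

  follow-exits : ∀ {v w ss} → IsWalk G v ss w → ∀ (D : ExitLists) → (∀ x → D x ≡ exits x ss) →
    ∀ f → length ss ≤ f → follow f v D ≡ ss
  follow-exits stop D D≡ zero _ = refl
  follow-exits {v} stop D D≡ (suc f) _ rewrite D≡ v = refl
  follow-exits {v} (step {s = st} {ss = ss} tail≡v walk) D D≡ (suc f) (s≤s len≤f)
    rewrite D≡ v | exits-∷-≡ st ss tail≡v | exitStep-tail st tail≡v =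
    cong (st ∷_) (follow-exits walk (update D v (exits v ss)) D′≡ f len≤f)
    where
    D′≡ : ∀ x → update D v (exits v ss) x ≡ exits x ss
    D′≡ x with x ≟ v
    ... | yes refl = refl
    ... | no x≢v = trans (D≡ x) (exits-∷-≢ st ss λ tail≡x → x≢v (trans (sym tail≡x) tail≡v))

  record FollowResult (v : Fin n) (D : ExitLists) (ss : List (Step m)) : Set where
    field
      end : Fin n
      walk : IsWalk G v ss end
      unused : ExitLists
      exits-++-unused : ∀ x → D x ≡ exits x ss ++ unused x
      unused-end : unused end ≡ []

  followResult-∷ : ∀ {v D e r ss} → D v ≡ e ∷ r → Incident v e →
    FollowResult (head G (exitStep v e)) (update D v r) ss → FollowResult v D (exitStep v e ∷ ss)
  followResult-∷ {v} {D} {e} {r} {ss} Dv≡ v∼e R = record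
    { end = end ; walk = step (tail-exitStep v∼e) walk ; unused = unused
    ; exits-++-unused = exits-++-unused′ ; unused-end = unused-end }
    where
    open FollowResult R
    exits-++-unused′ : ∀ x → D x ≡ exits x (exitStep v e ∷ ss) ++ unused x
    exits-++-unused′ x with x ≟ v
    ... | yes refl = begin
      D x                                    ≡⟨ Dv≡ ⟩
      e ∷ r                                  ≡⟨ cong (e ∷_) (trans (sym (update-≡ D x r)) (exits-++-unused x)) ⟩
      e ∷ exits x ss ++ unused x             ≡⟨ cong (_++ unused x) (sym (exits-∷-≡ (exitStep x e) ss (tail-exitStep v∼e))) ⟩
      exits x (exitStep x e ∷ ss) ++ unused x ∎
      where open ≡-Reasoning
    ... | no x≢v = begin
      D x                                    ≡⟨ sym (update-≢ D v r x≢v) ⟩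
      update D v r x                         ≡⟨ exits-++-unused x ⟩
      exits x ss ++ unused x                 ≡⟨ cong (_++ unused x) (sym (exits-∷-≢ (exitStep v e) ss
                                                  λ tail≡x → x≢v (trans (sym tail≡x) (tail-exitStep v∼e)))) ⟩
      exits x (exitStep v e ∷ ss) ++ unused x ∎
      where open ≡-Reasoning

  exitCount : ExitLists → ℕ
  exitCount D = sumFin (length ∘ D)

  exitCount-update : ∀ D v {e r} → D v ≡ e ∷ r → suc (exitCount (update D v r)) ≡ exitCount D
  exitCount-update D v {e} {r} Dv≡ = +-cancelʳ-≡ (length r) _ _ (begin
    suc (exitCount D′) + length r    ≡⟨ sym (+-suc (exitCount D′) (length r)) ⟩
    exitCount D′ + length (e ∷ r)    ≡⟨ cong (λ l → exitCount D′ + length l) (sym Dv≡) ⟩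
    exitCount D′ + length (D v)      ≡⟨ sumFin-update (length ∘ D′) (length ∘ D) v (λ x x≢v → cong length (update-≢ D v r x≢v)) ⟩
    exitCount D + length (D′ v)      ≡⟨ cong (λ l → exitCount D + length l) (update-≡ D v r) ⟩
    exitCount D + length r           ∎)
    where
    open ≡-Reasoning
    D′ = update D v r

  following : ∀ f v (D : ExitLists) → (∀ x → All (Incident x) (D x)) → exitCount D ≤ f →
    FollowResult v D (follow f v D)
  following zero v D _ count≤0 = record
    { end = v ; walk = stop ; unused = D ; exits-++-unused = λ _ → refl
    ; unused-end = length≡0 (n≤0⇒n≡0 (≤-trans (≤-sumFin (length ∘ D) v) count≤0)) }
    where
    length≡0 : ∀ {xs : List (Fin m)} → length xs ≡ 0 → xs ≡ []
    length≡0 {[]} _ = refl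
  following (suc f) v D incident count≤ = via (D v) refl
    where
    via : ∀ l → D v ≡ l → FollowResult v D (followVia f v D l)
    via [] Dv≡[] = record { end = v ; walk = stop ; unused = D ; exits-++-unused = λ _ → refl ; unused-end = Dv≡[] }
    via (e ∷ r) Dv≡ = followResult-∷ Dv≡ (All.lookup (incident v) (subst (e ∈_) (sym Dv≡) (here refl)))
      (following f _ (update D v r) incident′ (≤-pred (≤-trans (≤-reflexive (exitCount-update D v Dv≡)) count≤)))
      where
      incident′ : ∀ x → All (Incident x) (update D v r x)
      incident′ x with x ≟ v
      ... | yes refl = All.tail (subst (All (Incident x)) Dv≡ (incident x))
      ... | no _ = incident x

  LastExitsDescend : Fin n → (Fin n → ℕ) → ExitLists → Set
  LastExitsDescend u d D = ∀ x → x ≢ u →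
    Σ (Fin m) λ p → Incident x p × (∃ λ D₀ → D x ≡ D₀ ++ [ p ]) × d (opposite p x) < d x

  module LastExitTour (u : Fin n) (k : Fin m → ℕ) (D : ExitLists)
    (D-incident : ∀ x → All (Incident x) (D x))
    (occ-D : ∀ x {e} → Incident x e → occ e (D x) ≡ k e)
    {ss : List (Step m)} (R : FollowResult u D ss) where

    open FollowResult R

    private
      sum-over-incident : ∀ x {ys} → All (Incident x) ys →
        length ys ≡ sum (map (λ e → occ e ys) (incidentEdges G x))
      sum-over-incident x {ys} ys∼x =
        length-≡-sum-occ (incidentEdges G x) (incidentEdges-unique x) ys (All.map ∈-incidentEdges⁺ ys∼x)

    length-D : ∀ x → length (D x) ≡ s G k x
    length-D x = trans (sum-over-incident x (D-incident x))
                       (sum-map-cong (incidentEdges G x) (λ e∈ → occ-D x (∈-incidentEdges⁻ e∈)))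

    length-exits-exhausted : ∀ x → unused x ≡ [] → length (exits x ss) ≡ s G k x
    length-exits-exhausted x unused≡[] = begin
      length (exits x ss)                ≡⟨ cong length (sym (++-identityʳ (exits x ss))) ⟩
      length (exits x ss ++ [])          ≡⟨ cong (λ r → length (exits x ss ++ r)) (sym unused≡[]) ⟩
      length (exits x ss ++ unused x)    ≡⟨ cong length (sym (exits-++-unused x)) ⟩
      length (D x)                       ≡⟨ length-D x ⟩
      s G k x                            ∎
      where open ≡-Reasoning

    occ-exits-≤ : ∀ x {e} → Incident x e → occ e (exits x ss) ≤ k e
    occ-exits-≤ x {e} x∼e = begin
      occ e (exits x ss)                        ≤⟨ m≤m+n _ _ ⟩
      occ e (exits x ss) + occ e (unused x)     ≡⟨ sym (occ-++ e (exits x ss) (unused x)) ⟩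
      occ e (exits x ss ++ unused x)            ≡⟨ cong (occ e) (sym (exits-++-unused x)) ⟩
      occ e (D x)                               ≡⟨ occ-D x x∼e ⟩
      k e                                       ∎
      where open ≤-Reasoning

    length-entries : ∀ x → length (entries x ss) ≡ sum (map (λ e → occ e (exits (opposite e x) ss)) (incidentEdges G x))
    length-entries x = trans (sum-over-incident x (entries-incident x ss))
                             (sum-map-cong _ (λ e∈ → occ-entries (∈-incidentEdges⁻ e∈) ss))

    length-entries-≤ : ∀ x → length (entries x ss) ≤ s G k x
    length-entries-≤ x = subst (_≤ s G k x) (sym (length-entries x))
      (sum-map-mono (incidentEdges G x) (λ e∈ → occ-exits-≤ _ (opposite-incident (∈-incidentEdges⁻ e∈))))

    -- A walk stuck at end ≠ u has left end along all s G k end exits, but entered it once more.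
    end≡u : end ≡ u
    end≡u with end ≟ u
    ... | yes eq = eq
    ... | no end≢u = ⊥-elim (<-irrefl refl (≤-trans (≤-reflexive entered) (length-entries-≤ end)))
      where
      entered : suc (s G k end) ≡ length (entries end ss)
      entered = begin
        suc (s G k end)                              ≡⟨ +-comm 1 (s G k end) ⟩
        s G k end + 1                                ≡⟨ cong₂ _+_ (sym (length-exits-exhausted end unused-end)) (sym (δ-refl end)) ⟩
        length (exits end ss) + δ end end            ≡⟨ exits-entries-balance walk end ⟩
        length (entries end ss) + δ u end            ≡⟨ cong (length (entries end ss) +_) (δ-≢ (end≢u ∘ sym)) ⟩
        length (entries end ss) + 0                  ≡⟨ +-identityʳ _ ⟩
        length (entries end ss)                      ∎
        where open ≡-Reasoning

    unused-u : unused u ≡ []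
    unused-u = subst (λ z → unused z ≡ []) end≡u unused-end

    length-exits≡entries : ∀ x → length (exits x ss) ≡ length (entries x ss)
    length-exits≡entries x = +-cancelʳ-≡ (δ u x) _ _
      (subst (λ z → length (exits x ss) + δ z x ≡ length (entries x ss) + δ u x) end≡u (exits-entries-balance walk x))

    -- If x still had unused exits, it was left along its last exit p fewer than k p times,
    -- so the other end q of p was entered fewer than s G k q times, yet left that often.
    unused-≡[]-from-last-exit : ∀ x p → Incident x p → (∃ λ D₀ → D x ≡ D₀ ++ [ p ]) →
      unused (opposite p x) ≡ [] → unused x ≡ []
    unused-≡[]-from-last-exit x p x∼p (D₀ , Dx≡) unused-q≡[] with unused x in unused-x≡
    ... | [] = refl
    ... | r ∷ rs = ⊥-elim (<-irrefl refl (subst (_< s G k q) q-balanced entries-q<))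
      where
      q = opposite p x
      exits-x-prefix : ∃ λ Q → D₀ ≡ exits x ss ++ Q
      exits-x-prefix = prefix-of-init (exits x ss) r rs D₀ p
        (trans (sym (trans (exits-++-unused x) (cong (exits x ss ++_) unused-x≡))) Dx≡)
      occ-D₀ : suc (occ p D₀) ≡ k p
      occ-D₀ = begin
        suc (occ p D₀)                  ≡⟨ +-comm 1 (occ p D₀) ⟩
        occ p D₀ + 1                    ≡⟨ cong (occ p D₀ +_) (sym (occ-here p [])) ⟩
        occ p D₀ + occ p [ p ]          ≡⟨ sym (occ-++ p D₀ [ p ]) ⟩
        occ p (D₀ ++ [ p ])             ≡⟨ cong (occ p) (sym Dx≡) ⟩
        occ p (D x)                     ≡⟨ occ-D x x∼p ⟩
        k p                             ∎
        where open ≡-Reasoning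
      occ-exits-x< : occ p (exits (opposite p q) ss) < k p
      occ-exits-x< with exits-x-prefix
      ... | Q , D₀≡ = subst (λ z → occ p (exits z ss) < k p) (sym (opposite-opposite x∼p))
        (≤-trans (s≤s (≤-trans (m≤m+n _ (occ p Q))
          (≤-reflexive (trans (sym (occ-++ p (exits x ss) Q)) (cong (occ p) (sym D₀≡)))))) (≤-reflexive occ-D₀))
      entries-q< : length (entries q ss) < s G k q
      entries-q< = subst (_< s G k q) (sym (length-entries q))
        (sum-map-mono-< (incidentEdges G q) (λ e∈ → occ-exits-≤ _ (opposite-incident (∈-incidentEdges⁻ e∈)))
          (∈-incidentEdges⁺ (opposite-incident x∼p)) occ-exits-x<)
      q-balanced : length (entries q ss) ≡ s G k q
      q-balanced = trans (sym (length-exits≡entries q)) (length-exits-exhausted q unused-q≡[])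

    module _ (d : Fin n → ℕ) (lastExit : LastExitsDescend u d D) where

      unused-≡[] : ∀ x → unused x ≡ []
      unused-≡[] x = below (suc (d x)) x ≤-refl
        where
        below : ∀ N x → d x < N → unused x ≡ []
        below (suc N) x dx<N with x ≟ u
        ... | yes refl = unused-u
        ... | no x≢u with lastExit x x≢u
        ...   | p , x∼p , last , closer = unused-≡[]-from-last-exit x p x∼p last (below N _ (<-≤-trans closer (≤-pred dx<N)))

      exits≡D : ∀ x → exits x ss ≡ D x
      exits≡D x = sym (trans (exits-++-unused x) (trans (cong (exits x ss ++_) (unused-≡[] x)) (++-identityʳ _)))

      balancedTour : IsBalancedTour G k u ss
      balancedTour = subst (IsWalk G u ss) end≡u walk , λ e →
        trans (traversals-true e ss) (trans (cong (occ e) (exits≡D _)) (occ-D _ (inj₁ refl))) ,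
        trans (traversals-false e ss) (trans (cong (occ e) (exits≡D _)) (occ-D _ (inj₂ refl)))

-- Trees

acyclic⇒loopless : ∀ {n m} (G : Graph n m) → Acyclic G → ∀ e → proj₁ (ends G e) ≢ proj₂ (ends G e)
acyclic⇒loopless G acyclic e loop = acyclic (proj₁ (ends G e)) (e , true) []
  (step refl (subst (λ z → IsWalk G z [] (proj₁ (ends G e))) loop stop)) ([] ∷ [])

least-witness : (P : ℕ → Set) → (∀ L → Dec (P L)) → ∀ B → P B → Σ ℕ λ d → P d × (∀ L → P L → d ≤ L)
least-witness P P? zero p = 0 , p , λ _ _ → z≤n
least-witness P P? (suc B) p with P? 0
... | yes p₀ = 0 , p₀ , λ _ _ → z≤n
... | no ¬p₀ with least-witness (P ∘ suc) (P? ∘ suc) B p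
...   | d , pd , least = suc d , pd , λ { zero p₀ → ⊥-elim (¬p₀ p₀) ; (suc L) pL → s≤s (least L pL) }

module RootedTree {n m} (T : Graph n m) (tree : IsTree T) (u : Fin n) where

  open Loopless T (acyclic⇒loopless T (proj₂ tree)) public

  WalkToRootOfLength : Fin n → ℕ → Set
  WalkToRootOfLength x L = Any (λ ss → IsWalk T x ss u) (listsOf (allSteps m) L)

  walkToRootOfLength : ∀ {x ss} → IsWalk T x ss u → WalkToRootOfLength x (length ss)
  walkToRootOfLength {ss = ss} walk =
    Any.map (λ { refl → walk }) (∈-listsOf⁺ (allSteps m) ss (All.tabulate λ {st} _ → ∈-allSteps st))

  shortestWalkToRoot : ∀ x → Σ ℕ λ d → WalkToRootOfLength x d × (∀ L → WalkToRootOfLength x L → d ≤ L)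
  shortestWalkToRoot x = least-witness (WalkToRootOfLength x)
    (λ L → Any.any? (λ ss → isWalk? T x ss u) (listsOf (allSteps m) L))
    (length (proj₁ (proj₁ tree x u))) (walkToRootOfLength (proj₂ (proj₁ tree x u)))

  distance : Fin n → ℕ
  distance x = proj₁ (shortestWalkToRoot x)

  parent : ∀ x → x ≢ u → Σ (Fin m) λ p → Incident x p × distance (opposite p x) < distance x
  parent x x≢u with find (proj₁ (proj₂ (shortestWalkToRoot x)))
  ... | ss , ss∈ , walk = firstStep ss (∈-listsOf⁻ (allSteps m) _ ss∈) walk
    where
    firstStep : ∀ ss → length ss ≡ distance x → IsWalk T x ss u →
      Σ (Fin m) λ p → Incident x p × distance (opposite p x) < distance x
    firstStep [] _ stop = ⊥-elim (x≢u refl)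
    firstStep (st ∷ ss) len≡ (step tail≡x walk) =
      proj₁ st , tail-incident st tail≡x ,
      subst (λ z → distance z < distance x) (head-≡-opposite st tail≡x)
        (≤-trans (s≤s (proj₂ (proj₂ (shortestWalkToRoot (head T st))) (length ss) (walkToRootOfLength walk)))
                 (≤-reflexive len≡))

module TourBounds {n m} (T : Graph n m) (tree : IsTree T) (u : Fin n) (k : Fin m → ℕ) where

  open RootedTree T tree u
  open Arrangements {Fin m} _≟_

  tourLength : ℕ
  tourLength = 2 * sum (map k (allFin m))

  balancedTours : List (List (Step m))
  balancedTours = filter (balanced? T k u) (listsOf (allSteps m) tourLength)

  balancedTours-unique : Unique balancedTours
  balancedTours-unique = Unique.filter⁺ (balanced? T k u) (listsOf-unique (allSteps m) tourLength (allSteps-unique m))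

  length-balancedTour : ∀ {ss} → IsBalancedTour T k u ss → length ss ≡ tourLength
  length-balancedTour {ss} (_ , counts) = begin
    length ss                                                    ≡⟨ length-≡-sum-traversals ss ⟩
    sumFin (λ e → traversals e true ss + traversals e false ss)  ≡⟨ sumFin-cong (λ e → cong₂ _+_ (proj₁ (counts e)) (proj₂ (counts e))) ⟩
    sumFin (λ e → k e + k e)                                     ≡⟨ sum-map-+ {f = k} {g = k} (allFin m) ⟩
    sum (map k (allFin m)) + sum (map k (allFin m))              ≡⟨ cong (sum (map k (allFin m)) +_) (sym (+-identityʳ _)) ⟩
    tourLength                                                   ∎
    where open ≡-Reasoning

  ∈-balancedTours⁺ : ∀ {ss} → IsBalancedTour T k u ss → ss ∈ balancedTours
  ∈-balancedTours⁺ {ss} balanced = ∈-filter⁺ (balanced? T k u)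
    (subst (λ L → ss ∈ listsOf (allSteps m) L) (length-balancedTour balanced)
           (∈-listsOf⁺ (allSteps m) ss (All.tabulate λ {st} _ → ∈-allSteps st)))
    balanced

  ∈-balancedTours⁻ : ∀ {ss} → ss ∈ balancedTours → IsBalancedTour T k u ss
  ∈-balancedTours⁻ ss∈ = proj₂ (∈-filter⁻ (balanced? T k u) {xs = listsOf (allSteps m) tourLength} ss∈)

  exitWords : Fin n → List (List (Fin m))
  exitWords v = arrangements (incidentEdges T v) k

  exits-∈-exitWords : ∀ {ss} → IsBalancedTour T k u ss → ∀ v → exits v ss ∈ exitWords v
  exits-∈-exitWords {ss} (_ , counts) v =
    ∈-arrangements⁺ (incidentEdges T v) k (incidentEdges-unique v) (exits v ss)
      (All.map ∈-incidentEdges⁺ (exits-incident v ss))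
      λ {e} e∈ → trans (occ-exits (∈-incidentEdges⁻ e∈) ss) (traversed-k e (direction e v))
    where
    traversed-k : ∀ e d → traversals e d ss ≡ k e
    traversed-k e true = proj₁ (counts e)
    traversed-k e false = proj₂ (counts e)

  balancedTour-exits-injective : ∀ {ss ss′} → IsBalancedTour T k u ss → IsBalancedTour T k u ss′ →
    (∀ v → exits v ss ≡ exits v ss′) → ss ≡ ss′
  balancedTour-exits-injective {ss} {ss′} b b′ same = trans
    (sym (follow-exits (proj₁ b) (λ v → exits v ss) (λ _ → refl) tourLength (≤-reflexive (length-balancedTour b))))
    (follow-exits (proj₁ b′) (λ v → exits v ss) same tourLength (≤-reflexive (length-balancedTour b′)))

  upper : WB T k u ≤ product (map (λ v → multinomial (localK T k v)) (allFin n))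
  upper = begin
    length balancedTours         ≤⟨ length-≤-injection exitVector balancedTours (choices exitWords) balancedTours-unique injective mem ⟩
    length (choices exitWords)   ≡⟨ length-choices-product exitWords _ (λ v → length-arrangements (incidentEdges T v) k) ⟩
    product (map (λ v → multinomial (localK T k v)) (allFin n)) ∎
    where
    open ≤-Reasoning
    exitVector : List (Step m) → Vec (List (Fin m)) n
    exitVector ss = Vec.tabulate (λ v → exits v ss)
    mem : ∀ {ss} → ss ∈ balancedTours → exitVector ss ∈ choices exitWords
    mem {ss} ss∈ = ∈-choices⁺ exitWords (exitVector ss) λ v →
      subst (_∈ exitWords v) (sym (Vec.lookup∘tabulate (λ v → exits v ss) v)) (exits-∈-exitWords (∈-balancedTours⁻ ss∈) v)
    injective : ∀ {ss ss′} → ss ∈ balancedTours → ss′ ∈ balancedTours → exitVector ss ≡ exitVector ss′ → ss ≡ ss′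
    injective {ss} {ss′} ss∈ ss′∈ eq = balancedTour-exits-injective (∈-balancedTours⁻ ss∈) (∈-balancedTours⁻ ss′∈) λ v →
      trans (sym (Vec.lookup∘tabulate (λ v → exits v ss) v))
            (trans (cong (λ V → lookup V v) eq) (Vec.lookup∘tabulate (λ v → exits v ss′) v))

  finalExits : Fin n → List (Fin m)
  finalExits x with x ≟ u
  ... | yes _ = incidentEdges T x
  ... | no x≢u = removeAll (proj₁ (parent x x≢u)) (incidentEdges T x) ++ [ proj₁ (parent x x≢u) ]

  occ-finalExits : ∀ x {e} → Incident x e → occ e (finalExits x) ≡ 1
  occ-finalExits x x∼e with x ≟ u
  ... | yes _ = occ-unique _ (incidentEdges-unique x) (∈-incidentEdges⁺ x∼e)
  ... | no _ = occ-moveToEnd _ _ (incidentEdges-unique x) (∈-incidentEdges⁺ x∼e)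

  finalExits-incident : ∀ x → All (Incident x) (finalExits x)
  finalExits-incident x with x ≟ u
  ... | yes _ = All.tabulate ∈-incidentEdges⁻
  ... | no x≢u = Allₚ.++⁺ (All.tabulate (∈-incidentEdges⁻ ∘ ∈-removeAll⁻ _)) (proj₁ (proj₂ (parent x x≢u)) ∷ [])

  shortWords : Fin n → List (List (Fin m))
  shortWords v = arrangements (incidentEdges T v) (λ e → k e ∸ 1)

  exitListsFor : Vec (List (Fin m)) n → ExitLists
  exitListsFor W x = lookup W x ++ finalExits x

  tourFor : Vec (List (Fin m)) n → List (Step m)
  tourFor W = follow (exitCount (exitListsFor W)) u (exitListsFor W)

  module TourFor (positive : ∀ e → 1 ≤ k e) {W} (W∈ : W ∈ choices shortWords) where

    D-incident : ∀ x → All (Incident x) (exitListsFor W x)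
    D-incident x = Allₚ.++⁺ (All.map ∈-incidentEdges⁻ (proj₂ (∈-arrangements⁻ _ _ (∈-choices⁻ shortWords W∈ x))))
                           (finalExits-incident x)

    occ-D : ∀ x {e} → Incident x e → occ e (exitListsFor W x) ≡ k e
    occ-D x {e} x∼e = begin
      occ e (lookup W x ++ finalExits x)         ≡⟨ occ-++ e (lookup W x) (finalExits x) ⟩
      occ e (lookup W x) + occ e (finalExits x)  ≡⟨ cong₂ _+_ (occ-∈-arrangements (incidentEdges T x) (λ e → k e ∸ 1)
                                                       (incidentEdges-unique x) (∈-choices⁻ shortWords W∈ x) (∈-incidentEdges⁺ x∼e))
                                                     (occ-finalExits x x∼e) ⟩
      k e ∸ 1 + 1                                ≡⟨ m∸n+n≡m (positive e) ⟩
      k e                                        ∎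
      where open ≡-Reasoning

    lastExit : LastExitsDescend u distance (exitListsFor W)
    lastExit x x≢u with x ≟ u
    ... | yes x≡u = ⊥-elim (x≢u x≡u)
    ... | no x≢u′ = p , proj₁ (proj₂ (parent x x≢u′)) ,
                    (lookup W x ++ removeAll p (incidentEdges T x) , sym (++-assoc (lookup W x) _ _)) ,
                    proj₂ (proj₂ (parent x x≢u′))
      where p = proj₁ (parent x x≢u′)

    open LastExitTour u k (exitListsFor W) D-incident occ-D (following _ u (exitListsFor W) D-incident ≤-refl)

    tourFor-balanced : IsBalancedTour T k u (tourFor W)
    tourFor-balanced = balancedTour distance lastExit

    exits-tourFor : ∀ x → exits x (tourFor W) ≡ exitListsFor W x
    exits-tourFor = exits≡D distance lastExit

  lower-positive : (∀ e → 1 ≤ k e) → product (map (λ v → multinomialPred (localK T k v)) (allFin n)) ≤ WB T k u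
  lower-positive positive = begin
    product (map (λ v → multinomialPred (localK T k v)) (allFin n)) ≡⟨ sym (length-choices-product shortWords _ length-shortWords) ⟩
    length (choices shortWords)   ≤⟨ length-≤-injection tourFor (choices shortWords) balancedTours
                                       (choices-unique shortWords λ v → arrangements-unique _ _ (incidentEdges-unique v)) injective mem ⟩
    length balancedTours          ∎
    where
    open ≤-Reasoning
    length-shortWords : ∀ v → length (shortWords v) ≡ multinomialPred (localK T k v)
    length-shortWords v = begin-equality
      length (shortWords v)                                  ≡⟨ length-arrangements (incidentEdges T v) (λ e → k e ∸ 1) ⟩
      multinomial (map (λ e → k e ∸ 1) (incidentEdges T v))  ≡⟨ cong multinomial (map-∘ (incidentEdges T v)) ⟩
      multinomial (map (_∸ 1) (localK T k v))                ≡⟨ sym (multinomialPred-positive (localK T k v)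
                                                                   (Allₚ.map⁺ (All.tabulate λ {e} _ → n>0⇒n≢0 (positive e)))) ⟩
      multinomialPred (localK T k v)                         ∎
    mem : ∀ {W} → W ∈ choices shortWords → tourFor W ∈ balancedTours
    mem W∈ = ∈-balancedTours⁺ (TourFor.tourFor-balanced positive W∈)
    injective : ∀ {W W′} → W ∈ choices shortWords → W′ ∈ choices shortWords → tourFor W ≡ tourFor W′ → W ≡ W′
    injective {W} {W′} W∈ W′∈ eq = lookup-injective W W′ λ x → ++-cancelʳ (finalExits x) (lookup W x) (lookup W′ x)
      (trans (sym (TourFor.exits-tourFor positive W∈ x))
             (trans (cong (exits x) eq) (TourFor.exits-tourFor positive W′∈ x)))

  lower : product (map (λ v → multinomialPred (localK T k v)) (allFin n)) ≤ WB T k u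
  lower with any? (λ e → k e ≟ℕ 0)
  ... | no none = lower-positive λ e → n≢0⇒n>0 λ ke≡0 → none (e , ke≡0)
  ... | yes (e , ke≡0) = subst (_≤ WB T k u) (sym (product≡0 zeroFactor)) z≤n
    where
    a = proj₁ (ends T e)
    zeroFactor : 0 ∈ map (λ v → multinomialPred (localK T k v)) (allFin n)
    zeroFactor = subst (_∈ _) (multinomialPred-∋0 (localK T k a) (subst (_∈ localK T k a) ke≡0 (∈-map⁺ k (∈-incidentEdges⁺ (inj₁ refl)))))
                   (∈-map⁺ (λ v → multinomialPred (localK T k v)) (∈-allFin a))

corollary2p3 : ∀ {n m : ℕ} (T : Graph n m) → IsTree T → (u : Fin n) → (k : Fin m → ℕ) →
    (product (map (λ v → multinomialPred (localK T k v)) (allFin n)) ≤ WB T k u)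
    × (WB T k u ≤ product (map (λ v → multinomial (localK T k v)) (allFin n)))
corollary2p3 T tree u k = lower , upper
  where open TourBounds T tree u k
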